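{- For every integer $N\ge 1$, all the numbers $\mathcal{E}_{Nn}^{(N,0)}$ ($n\ge 0$) are integers. Moreover, for every prime $p$ and every integer $j$ with $0\le j\le p-1$, all the numbers $\mathcal{E}_{pn}^{(p,j)}$ ($n\ge0$) are $p$-adic integers, i.e. the denominator of $\mathcal{E}_{pn}^{(p,j)}$ written as a reduced fraction is not divisible by $p$.
   Context: For integers $N\ge 1$ and $j\ge 0$, the congruential Euler numbers $\mathcal{E}_n^{(N,j)}\in\mathbb{Q}$ ($n\ge 0$) are defined by the identity of formal power series \[\sum_{n=0}^\infty \mathcal{E}_n^{(N,j)}\frac{z^n}{n!}=\left(\sum_{n=0}^\infty \frac{z^{Nn}}{(Nn+j)!}\right)^{ -1}.\] -}

module Defs where

open import Data.Nat as ℕ using (ℕ; zero; suc; _≤?_; _!)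
open import Data.Nat.Properties using (_!≢0)
open import Data.Nat.Divisibility using (_∣?_)
open import Data.Nat.Combinatorics using (_C_)
open import Data.Rational as ℚ using (ℚ; _+_; _-_; _*_; 0ℚ; 1ℚ; _/_)
open import Data.Integer as ℤ using (+_)
open import Data.List using (List; []; _∷_; map; upTo; foldr)
open import Relation.Nullary using (yes; no)

-- Write S(z) = Σ_n z^(Nn)/(Nn+j)! = Σ_m a_m z^m/m!.  Then
--   a_m = m!/(m+j)!  if N ∣ m,   a_m = 0 otherwise.
coeff : (N j m : ℕ) → ℚ
coeff N j m with N ∣? m
... | yes _ = ((+ (m !)) / ((m ℕ.+ j) !)) {{(m ℕ.+ j) !≢0}}
... | no _ = 0ℚ

sumℚ : List ℚ → ℚ
sumℚ = foldr _+_ 0ℚ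

nℚ : ℕ → ℚ
nℚ n = (+ n) / 1

-- The table E n k = E_k^{(N,j)} for k ≤ n (values for k > n are junk,
-- never used).  E_0 = 1/a_0 = j!, and for m ≥ 1 the coefficient of z^m/m!
-- in S(z)·E(z) = 1 gives  Σ_{k=0}^{m} C(m,k) a_k E_{m-k} = 0, i.e.
--   E_m = - j! · Σ_{k=1}^{m} C(m,k) a_k E_{m-k}.
table : (N j : ℕ) → ℕ → ℕ → ℚ
table N j zero k = nℚ (j !)
table N j (suc n) k with k ≤? n
... | yes _ = table N j n k
... | no _ = ℚ.- (nℚ (j !) * sumℚ (map term (upTo (suc n))))
  where
    -- i ranges over 0..n, representing k' = i+1 in 1..n+1 = m
    term : ℕ → ℚ
    term i = nℚ (suc n C suc i) * coeff N j (suc i) * table N j n (n ℕ.∸ i)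

𝓔 : (N j n : ℕ) → ℚ
𝓔 N j n = table N j n n

-- Through the recurrence 𝓔_m = -j! Σ_{k≥1} C(m,k) a_k 𝓔_{m-k}, every 𝓔_n^{(N,j)} is
-- obtained from integers and the coefficients a_m = m!/(m + j)! by ring operations.
-- If S is a set of positive integers closed under products and divisors, the
-- rationals whose reduced denominator lies in S form a subring S⁻¹ℤ of ℚ, so it
-- suffices that every a_m lies in S⁻¹ℤ.  The nonzero a_m (those with N ∣ m) have
-- denominator (m + 1)(m + 2)⋯(m + j): this is 1 when j = 0, and it is prime to p
-- when p ∣ m and j < p, since each factor m + i has 0 < i < p.  Take S = {1} and
-- S = {d : p ∤ d}.
module Submission where

open import Defs
open import Data.Nat as ℕ using (ℕ; zero; suc; _+_; _*_; _<_; _≤_; _!; NonZero)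
open import Data.Nat.Properties
  using (_!≢0; *-comm; *-assoc; *-identityʳ; +-identityʳ; +-suc; *-cancelʳ-≡; <-trans; n<1+n; <⇒≱)
open import Data.Nat.Combinatorics using (_C_)
open import Data.Nat.Divisibility
  using (_∣_; divides; _∣?_; ∣-refl; ∣-trans; ∣-antisym; ∣1⇒≡1; ∣⇒≤; ∣m+n∣m⇒∣n; m∣m*n)
open import Data.Nat.GCD using (gcd; gcd[m,n]∣m; gcd-greatest)
open import Data.Nat.Primality using (Prime; euclidsLemma; ¬prime[1])
open import Data.Rational as ℚ using (ℚ; ↧_; ↧ₙ_; _/_)
open import Data.Rational.Properties using (↧-/; ↧-neg)
open import Data.Integer as ℤ using (ℤ; +_; ∣_∣)
open import Data.Integer.Properties using (abs-*)
open import Data.Integer.GCD as ℤ using ()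
open import Data.List using ([]; _∷_; map; upTo)
open import Data.Product using (_×_; _,_)
open import Data.Sum using ([_,_])
open import Relation.Nullary using (¬_; yes; no)
open import Relation.Binary.PropositionalEquality
  using (_≡_; sym; trans; cong; cong₂; subst; module ≡-Reasoning)

↧ₙ[i/n]*gcd≡n : ∀ (i : ℤ) n .{{_ : NonZero n}} → ↧ₙ (i / n) * gcd ∣ i ∣ n ≡ n
↧ₙ[i/n]*gcd≡n i n = trans (sym (abs-* (↧ (i / n)) (ℤ.gcd i (+ n)))) (cong ∣_∣ (↧-/ i n))

↧ₙ[i/n]∣n : ∀ (i : ℤ) n .{{_ : NonZero n}} → ↧ₙ (i / n) ∣ n
↧ₙ[i/n]∣n i n = divides (gcd ∣ i ∣ n) (trans (sym (↧ₙ[i/n]*gcd≡n i n)) (*-comm (↧ₙ (i / n)) _))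

m*d≡n⇒↧ₙ[m/n]≡d : ∀ m d n .{{_ : NonZero m}} .{{_ : NonZero n}} →
                  m * d ≡ n → ↧ₙ (+ m / n) ≡ d
m*d≡n⇒↧ₙ[m/n]≡d m d n m*d≡n = *-cancelʳ-≡ _ _ m (begin
  ↧ₙ (+ m / n) * m         ≡⟨ cong (↧ₙ (+ m / n) *_) gcd≡m ⟨
  ↧ₙ (+ m / n) * gcd m n   ≡⟨ ↧ₙ[i/n]*gcd≡n (+ m) n ⟩
  n                        ≡⟨ m*d≡n ⟨
  m * d                    ≡⟨ *-comm m d ⟩
  d * m                    ∎)
  where
  open ≡-Reasoning
  gcd≡m : gcd m n ≡ m
  gcd≡m = ∣-antisym (gcd[m,n]∣m m n) (gcd-greatest ∣-refl (subst (m ∣_) m*d≡n (m∣m*n d)))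

↧ₙ[p+q]∣↧ₙp*↧ₙq : ∀ p q → ↧ₙ (p ℚ.+ q) ∣ ↧ₙ p * ↧ₙ q
↧ₙ[p+q]∣↧ₙp*↧ₙq p@record{} q@record{} =
  ↧ₙ[i/n]∣n (ℚ.↥ p ℤ.* ↧ q ℤ.+ ℚ.↥ q ℤ.* ↧ p) (↧ₙ p * ↧ₙ q)

↧ₙ[p*q]∣↧ₙp*↧ₙq : ∀ p q → ↧ₙ (p ℚ.* q) ∣ ↧ₙ p * ↧ₙ q
↧ₙ[p*q]∣↧ₙp*↧ₙq p@record{} q@record{} = ↧ₙ[i/n]∣n (ℚ.↥ p ℤ.* ℚ.↥ q) (↧ₙ p * ↧ₙ q)

↧ₙ[-p]≡↧ₙp : ∀ p → ↧ₙ (ℚ.- p) ≡ ↧ₙ p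
↧ₙ[-p]≡↧ₙp p = cong ∣_∣ (↧-neg p)

record IsSaturated (S : ℕ → Set) : Set where
  field
    1∈S      : S 1
    ∣-closed : ∀ {m n} → m ∣ n → S n → S m
    *-closed : ∀ {m n} → S m → S n → S (m * n)

∣1-isSaturated : IsSaturated (_∣ 1)
∣1-isSaturated = record
  { 1∈S      = ∣-refl
  ; ∣-closed = ∣-trans
  ; *-closed = λ m∣1 n∣1 → subst (_∣ 1) (sym (cong₂ _*_ (∣1⇒≡1 m∣1) (∣1⇒≡1 n∣1))) ∣-refl
  }

∤-isSaturated : ∀ {p} → Prime p → IsSaturated (λ n → ¬ p ∣ n)
∤-isSaturated p-prime = record
  { 1∈S      = λ p∣1 → ¬prime[1] (subst Prime (∣1⇒≡1 p∣1) p-prime)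
  ; ∣-closed = λ m∣n p∤n p∣m → p∤n (∣-trans p∣m m∣n)
  ; *-closed = λ {m} {n} p∤m p∤n p∣m*n → [ p∤m , p∤n ] (euclidsLemma m n p-prime p∣m*n)
  }

_↑_ : ℕ → ℕ → ℕ
m ↑ zero  = 1
m ↑ suc j = m ↑ j * (m + suc j)

m!*m↑j≡[m+j]! : ∀ m j → m ! * m ↑ j ≡ (m + j) !
m!*m↑j≡[m+j]! m zero = trans (*-identityʳ (m !)) (cong _! (sym (+-identityʳ m)))
m!*m↑j≡[m+j]! m (suc j) = begin
  m ! * (m ↑ j * (m + suc j))  ≡⟨ *-assoc (m !) _ _ ⟨
  m ! * m ↑ j * (m + suc j)    ≡⟨ cong₂ _*_ (m!*m↑j≡[m+j]! m j) (+-suc m j) ⟩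
  (m + j) ! * suc (m + j)      ≡⟨ *-comm ((m + j) !) _ ⟩
  suc (m + j) !                ≡⟨ cong _! (+-suc m j) ⟨
  (m + suc j) !                ∎
  where open ≡-Reasoning

↧ₙ[m!/[m+j]!]≡m↑j : ∀ m j → ↧ₙ ((+ (m !) / (m + j) !) {{(m + j) !≢0}}) ≡ m ↑ j
↧ₙ[m!/[m+j]!]≡m↑j m j =
  m*d≡n⇒↧ₙ[m/n]≡d (m !) (m ↑ j) ((m + j) !) {{m !≢0}} {{(m + j) !≢0}} (m!*m↑j≡[m+j]! m j)

p∤m↑j : ∀ {p m j} → Prime p → p ∣ m → j < p → ¬ p ∣ m ↑ j
p∤m↑j {j = zero} p-prime _ _ = IsSaturated.1∈S (∤-isSaturated p-prime)
p∤m↑j {p} {m} {suc j} p-prime p∣m j<p =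
  IsSaturated.*-closed (∤-isSaturated p-prime)
    (p∤m↑j p-prime p∣m (<-trans (n<1+n j) j<p)) p∤m+suc[j]
  where
  p∤m+suc[j] : ¬ p ∣ m + suc j
  p∤m+suc[j] p∣m+suc[j] = <⇒≱ j<p (∣⇒≤ (∣m+n∣m⇒∣n p∣m+suc[j] p∣m))

module S⁻¹ℤ {S : ℕ → Set} (isSaturated : IsSaturated S) where
  open IsSaturated isSaturated

  record _∈S⁻¹ℤ (q : ℚ) : Set where
    constructor ↧ₙ∈S
    field ↧ₙ-∈S : S (↧ₙ q)
  open _∈S⁻¹ℤ

  +-pres-∈ : ∀ {p q} → p ∈S⁻¹ℤ → q ∈S⁻¹ℤ → (p ℚ.+ q) ∈S⁻¹ℤ
  +-pres-∈ {p} {q} (↧ₙ∈S sp) (↧ₙ∈S sq) = ↧ₙ∈S (∣-closed (↧ₙ[p+q]∣↧ₙp*↧ₙq p q) (*-closed sp sq))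

  *-pres-∈ : ∀ {p q} → p ∈S⁻¹ℤ → q ∈S⁻¹ℤ → (p ℚ.* q) ∈S⁻¹ℤ
  *-pres-∈ {p} {q} (↧ₙ∈S sp) (↧ₙ∈S sq) = ↧ₙ∈S (∣-closed (↧ₙ[p*q]∣↧ₙp*↧ₙq p q) (*-closed sp sq))

  -‿pres-∈ : ∀ {p} → p ∈S⁻¹ℤ → (ℚ.- p) ∈S⁻¹ℤ
  -‿pres-∈ {p} (↧ₙ∈S sp) = ↧ₙ∈S (subst S (sym (↧ₙ[-p]≡↧ₙp p)) sp)

  nℚ-∈ : ∀ n → nℚ n ∈S⁻¹ℤ
  nℚ-∈ n = ↧ₙ∈S (∣-closed (↧ₙ[i/n]∣n (+ n) 1) 1∈S)

  sumℚ-∈ : ∀ {f : ℕ → ℚ} → (∀ i → f i ∈S⁻¹ℤ) → ∀ l → sumℚ (map f l) ∈S⁻¹ℤ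
  sumℚ-∈ f∈ []      = ↧ₙ∈S 1∈S
  sumℚ-∈ f∈ (i ∷ l) = +-pres-∈ (f∈ i) (sumℚ-∈ f∈ l)

  coeff-∈ : ∀ {N j} → (∀ m → N ∣ m → S (m ↑ j)) → ∀ m → coeff N j m ∈S⁻¹ℤ
  coeff-∈ {N} {j} m↑j∈S m with N ∣? m
  ... | yes N∣m = ↧ₙ∈S (subst S (sym (↧ₙ[m!/[m+j]!]≡m↑j m j)) (m↑j∈S m N∣m))
  ... | no _    = ↧ₙ∈S 1∈S

  module _ {N j} (coeff∈ : ∀ m → coeff N j m ∈S⁻¹ℤ) where
    table-∈ : ∀ n k → table N j n k ∈S⁻¹ℤ
    table-∈ zero    k = nℚ-∈ (j !)
    table-∈ (suc n) k with k ℕ.≤? n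
    ... | yes _ = table-∈ n k
    ... | no _  = -‿pres-∈ (*-pres-∈ (nℚ-∈ (j !)) (sumℚ-∈ term-∈ (upTo (suc n))))
      where
      term-∈ : ∀ i → (nℚ (suc n C suc i) ℚ.* coeff N j (suc i) ℚ.* table N j n (n ℕ.∸ i)) ∈S⁻¹ℤ
      term-∈ i = *-pres-∈ (*-pres-∈ (nℚ-∈ (suc n C suc i)) (coeff∈ (suc i))) (table-∈ n (n ℕ.∸ i))

  ↧ₙ𝓔∈S : ∀ {N j} → (∀ m → N ∣ m → S (m ↑ j)) → ∀ n → S (↧ₙ (𝓔 N j n))
  ↧ₙ𝓔∈S m↑j∈S n = ↧ₙ-∈S (table-∈ (coeff-∈ m↑j∈S) n n)

corollary2p5 : ((N : ℕ) → 1 ≤ N → (n : ℕ) → ↧ₙ (𝓔 N 0 (N * n)) ≡ 1)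
    × ((p : ℕ) → Prime p → (j : ℕ) → j < p → (n : ℕ) → ¬ (p ∣ ↧ₙ (𝓔 p j (p * n))))
corollary2p5 =
  (λ N _ n → ∣1⇒≡1 (S⁻¹ℤ.↧ₙ𝓔∈S ∣1-isSaturated (λ _ _ → ∣-refl) (N * n))) ,
  (λ p p-prime j j<p n →
    S⁻¹ℤ.↧ₙ𝓔∈S (∤-isSaturated p-prime) (λ _ p∣m → p∤m↑j p-prime p∣m j<p) (p * n))
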